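{- Consider a Solitaire Hanabi instance with a single color ($c=1$), values in $\{1,\dots,n\}$, hand size $h$, and sequence of values $a_1,\dots,a_N$. Call the $i$-th card useless if there exist integers $w_1,\dots,w_{h+1}$ with $a_i<w_1<\dots<w_{h+1}\le n$ such that $a_j\notin\{w_1,\dots,w_{h+1}\}$ for all $j\in\{i+1,\dots,N\}$. Then no useless card is played in any winning play sequence.
   Context: Solitaire Hanabi with one color: the deck is a sequence of cards with values $a_1,\dots,a_N\in\{1,\dots,n\}$ (repetitions allowed), all of the same color. The single player knows the sequence, draws cards in order starting with an empty hand, and for each drawn card either discards it (lost forever), stores it in hand, or plays it immediately; at any time she may also play stored cards. At most $h$ cards may be stored in hand at any time. A card of value $a$ may be played if and only if the last played card has value $a-1$, or $a=1$ and no card has yet been played. A winning play sequence is one that eventually plays (one copy of) every value $1,\dots,n$. -}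

module Defs where

open import Data.Nat using (ℕ; zero; suc; _<_; _≤_)
open import Data.Fin using (Fin; fromℕ<)
import Data.Fin as F
open import Data.List using (List; []; _∷_; _++_; length)
open import Data.List.Membership.Propositional using (_∈_)
open import Data.Maybe using (Maybe; just; nothing)
open import Data.Product using (Σ; ∃; _×_; _,_)
open import Relation.Binary.PropositionalEquality using (_≡_)
open import Relation.Binary.Construct.Closure.ReflexiveTransitive using (Star)
open import Relation.Nullary using (¬_)

-- A game state for a deck of N cards (cards are indexed by Fin N, 0-based).
record State (N : ℕ) : Set where
  constructor st
  field
    pos    : ℕ              -- number of cards drawn so far
    hand   : List (Fin N)   -- indices of the cards stored in hand
    lastPl : Maybe ℕ        -- value of the last played card (nothing = none yet)
    played : List (Fin N)   -- indices of all cards played so far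

open State public

initial : (N : ℕ) → State N
initial N = st 0 [] nothing []

Playable : Maybe ℕ → ℕ → Set
Playable nothing  v = v ≡ 1
Playable (just u) v = v ≡ suc u

data Step {N : ℕ} (a : Fin N → ℕ) (h : ℕ) : State N → State N → Set where
  drawDiscard : ∀ {i hd l ps} (p : i < N) →
    Step a h (st i hd l ps) (st (suc i) hd l ps)
  drawStore : ∀ {i hd l ps} (p : i < N) → length hd < h →
    Step a h (st i hd l ps) (st (suc i) (fromℕ< p ∷ hd) l ps)
  drawPlay : ∀ {i hd l ps} (p : i < N) → Playable l (a (fromℕ< p)) →
    Step a h (st i hd l ps) (st (suc i) hd (just (a (fromℕ< p))) (fromℕ< p ∷ ps))
  playHand : ∀ {i xs ys l ps} (c : Fin N) → Playable l (a c) →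
    Step a h (st i (xs ++ c ∷ ys) l ps) (st i (xs ++ ys) (just (a c)) (c ∷ ps))

Reachable : {N : ℕ} → (Fin N → ℕ) → ℕ → State N → Set
Reachable {N} a h s = Star (Step a h) (initial N) s

Winning : {N : ℕ} → (Fin N → ℕ) → ℕ → State N → Set
Winning a n s = ∀ v → 1 ≤ v → v ≤ n → ∃ λ c → c ∈ played s × a c ≡ v

Useless : {N : ℕ} → (Fin N → ℕ) → (n h : ℕ) → Fin N → Set
Useless a n h i =
  Σ (Fin (suc h) → ℕ) λ w →
    (∀ k l → k F.< l → w k < w l) ×
    a i < w F.zero ×
    w (F.fromℕ h) ≤ n ×
    (∀ j → i F.< j → ∀ k → ¬ (a j ≡ w k))

module Submission where

-- Suppose the useless card i is played in a reachable
-- winning state s, and look at the state t just before the move that plays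
-- it.  Along any play sequence (1) the hand holds at most h cards, (2) every
-- card in hand has already been drawn, and (3) every played card has value at
-- most the last played value.  Since the game is won, each value w_k is
-- played by some card c_k; these h+1 cards are distinct (the w_k are), and
-- each comes before i in the deck (no later card has value w_k, and
-- a_i < w_k).  At t card i is drawn and playable, so every c_k is drawn; by
-- (3) none of them is played yet (its value exceeds a_i); and a drawn card
-- that is neither in hand nor played is lost forever.  Hence all h+1 cards c_k
-- are in hand at t, contradicting (1) by the pigeonhole principle.

open import Defs
open import Data.Nat using (ℕ; _≤_)
open import Data.Fin using (Fin)
open import Data.Product using (_×_)
open import Data.List.Membership.Propositional using (_∈_)
open import Relation.Nullary using (¬_)

open import Data.Nat using (suc; _<_; z≤n; s≤s)
open import Data.Nat.Properties
  using (≤-refl; ≤-trans; <⇒≤; <-≤-trans; <-irrefl; <-asym; n≤1+n; m≤n⇒m≤1+n; ≤-reflexive)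
open import Data.Fin using (toℕ; fromℕ<)
import Data.Fin as F
import Data.Fin.Properties as FP
open import Data.List using (List; _∷_; _++_; length; lookup)
open import Data.List.Properties using (length-++-sucʳ)
open import Data.List.Relation.Unary.Any using (here; there; index)
open import Data.List.Relation.Unary.Any.Properties using (lookup-index)
open import Data.List.Membership.Propositional.Properties using (∈-++⁺ˡ; ∈-++⁺ʳ; ∈-++⁻; ∈-insert)
import Data.List.Membership.DecPropositional as DecMembership
open import Data.Maybe using (Maybe; just; nothing)
open import Data.Product using (∃; ∃₂; _,_; proj₁; proj₂)
open import Data.Sum using (_⊎_; inj₁; inj₂)
open import Data.Empty using (⊥; ⊥-elim)
open import Function.Definitions using (Injective)
open import Relation.Binary using (Rel; tri<; tri≈; tri>)
open import Relation.Binary.PropositionalEquality using (_≡_; refl; sym; trans; cong)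
open import Relation.Binary.Construct.Closure.ReflexiveTransitive using (Star; ε; _◅_)
open import Relation.Nullary using (yes; no)
open import Relation.Unary using (Pred; Decidable)
open import Level using (Level; 0ℓ)

∈-++-insert : {A : Set} {x c : A} (xs : List A) {ys : List A} →
  x ∈ xs ++ ys → x ∈ xs ++ c ∷ ys
∈-++-insert xs m with ∈-++⁻ xs m
... | inj₁ m-xs = ∈-++⁺ˡ m-xs
... | inj₂ m-ys = ∈-++⁺ʳ xs (there m-ys)

injective-in-short-list : {A : Set} {m : ℕ} (L : List A) (f : Fin m → A) →
  Injective _≡_ _≡_ f → (∀ k → f k ∈ L) → length L < m → ⊥
injective-in-short-list L f f-injective mem short =
  FP.<⇒notInjective short position-injective
  where
  -- the position of f k in L; distinct elements sit at distinct positions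
  position : Fin _ → Fin (length L)
  position k = index (mem k)

  position-injective : Injective _≡_ _≡_ position
  position-injective {k} {l} eq = f-injective
    (trans (lookup-index (mem k)) (trans (cong (lookup L) eq) (sym (lookup-index (mem l)))))

StrictlyIncreasing : {m : ℕ} → (Fin m → ℕ) → Set
StrictlyIncreasing w = ∀ k l → k F.< l → w k < w l

increasing-monotone : {m : ℕ} {w : Fin m → ℕ} → StrictlyIncreasing w →
  ∀ {k l} → k F.≤ l → w k ≤ w l
increasing-monotone increasing {k} {l} k≤l with k FP.≟ l
... | yes refl = ≤-refl
... | no k≢l = <⇒≤ (increasing k l (FP.≤∧≢⇒< k≤l k≢l))

increasing-injective : {m : ℕ} {w : Fin m → ℕ} → StrictlyIncreasing w →
  Injective _≡_ _≡_ w
increasing-injective increasing {k} {l} eq with FP.<-cmp k l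
... | tri< k<l _ _ = ⊥-elim (<-irrefl eq (increasing k l k<l))
... | tri≈ _ k≡l _ = k≡l
... | tri> _ _ l<k = ⊥-elim (<-irrefl (sym eq) (increasing l k l<k))

first-step-where : {ℓa ℓr ℓp : Level} {A : Set ℓa} {R : Rel A ℓr} {P : Pred A ℓp} →
  Decidable P →
  ∀ {x y} → Star R x y → ¬ P x → P y →
  ∃₂ λ u u' → Star R x u × R u u' × Star R u' y × ¬ P u × P u'
first-step-where P? ε ¬Px Py = ⊥-elim (¬Px Py)
first-step-where P? {x} (_◅_ {j = x'} step path) ¬Px Py with P? x'
... | yes Px' = x , x' , ε , step , path , ¬Px , Px'
... | no ¬Px' with first-step-where P? path ¬Px' Py
...   | u , u' , before , step' , after , ¬Pu , Pu' =
  u , u' , step ◅ before , step' , after , ¬Pu , Pu'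

AtMostLast : Maybe ℕ → ℕ → Set
AtMostLast nothing  x = ⊥
AtMostLast (just u) x = x ≤ u

playable-exceeds : ∀ {l v x} → Playable l v → AtMostLast l x → x < v
playable-exceeds {just u} refl x≤u = s≤s x≤u

module Game {N : ℕ} (a : Fin N → ℕ) (h : ℕ) where

  open DecMembership (FP._≟_ {N}) using (_∈?_)

  Invariant : Pred (State N) 0ℓ → Set
  Invariant P = ∀ {t t'} → Step a h t t' → P t → P t'

  invariant-star : ∀ {P} → Invariant P → ∀ {t t'} → Star (Step a h) t t' → P t → P t'
  invariant-star inv ε Pt = Pt
  invariant-star inv (step ◅ path) Pt = invariant-star inv path (inv step Pt)

  HandBounded : Pred (State N) 0ℓ
  HandBounded t = length (hand t) ≤ h

  hand-bounded : Invariant HandBounded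
  hand-bounded (drawDiscard _) bound = bound
  hand-bounded (drawStore _ short) bound = short
  hand-bounded (drawPlay _ _) bound = bound
  hand-bounded (playHand {xs = xs} {ys} c _) bound =
    ≤-trans (n≤1+n _) (≤-trans (≤-reflexive (sym (length-++-sucʳ xs c ys))) bound)

  HandDrawn : Pred (State N) 0ℓ
  HandDrawn t = ∀ c → c ∈ hand t → toℕ c < pos t

  hand-drawn : Invariant HandDrawn
  hand-drawn (drawDiscard _) drawn c m = m≤n⇒m≤1+n (drawn c m)
  hand-drawn (drawStore p _) drawn c (here refl) = s≤s (≤-reflexive (FP.toℕ-fromℕ< p))
  hand-drawn (drawStore _ _) drawn c (there m) = m≤n⇒m≤1+n (drawn c m)
  hand-drawn (drawPlay _ _) drawn c m = m≤n⇒m≤1+n (drawn c m)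
  hand-drawn (playHand {xs = xs} _ _) drawn c m = drawn c (∈-++-insert xs m)

  -- Played values never exceed the last played value (they increase by one).
  PlayedBelow : Pred (State N) 0ℓ
  PlayedBelow t = ∀ c → c ∈ played t → AtMostLast (lastPl t) (a c)

  played-below : Invariant PlayedBelow
  played-below (drawDiscard _) below = below
  played-below (drawStore _ _) below = below
  played-below (drawPlay _ _) below c (here refl) = ≤-refl
  played-below (drawPlay _ playable) below c (there m) =
    <⇒≤ (playable-exceeds playable (below c m))
  played-below (playHand _ _) below c (here refl) = ≤-refl
  played-below (playHand _ playable) below c (there m) =
    <⇒≤ (playable-exceeds playable (below c m))

  Lost : Fin N → Pred (State N) 0ℓ
  Lost c t = toℕ c < pos t × ¬ (c ∈ hand t) × ¬ (c ∈ played t)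

  stays-lost : ∀ c → Invariant (Lost c)
  stays-lost c (drawDiscard _) (drawn , ∉hand , ∉played) = m≤n⇒m≤1+n drawn , ∉hand , ∉played
  stays-lost c (drawStore p _) (drawn , ∉hand , ∉played) = m≤n⇒m≤1+n drawn , ∉hand' , ∉played
    where
    ∉hand' : ¬ (c ∈ fromℕ< p ∷ _)
    ∉hand' (here refl) = <-irrefl (FP.toℕ-fromℕ< p) drawn
    ∉hand' (there m) = ∉hand m
  stays-lost c (drawPlay p _) (drawn , ∉hand , ∉played) = m≤n⇒m≤1+n drawn , ∉hand , ∉played'
    where
    ∉played' : ¬ (c ∈ fromℕ< p ∷ _)
    ∉played' (here refl) = <-irrefl (FP.toℕ-fromℕ< p) drawn
    ∉played' (there m) = ∉played m
  stays-lost c (playHand {xs = xs} d _) (drawn , ∉hand , ∉played) =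
    drawn , (λ m → ∉hand (∈-++-insert xs m)) , ∉played'
    where
    ∉played' : ¬ (c ∈ d ∷ _)
    ∉played' (here refl) = ∉hand (∈-insert xs)
    ∉played' (there m) = ∉played m

  drawn-and-later-played : ∀ {t s c} → Star (Step a h) t s →
    toℕ c < pos t → c ∈ played s → c ∈ hand t ⊎ c ∈ played t
  drawn-and-later-played {t} {c = c} path drawn played-later with c ∈? hand t | c ∈? played t
  ... | yes ∈hand | _ = inj₁ ∈hand
  ... | no _ | yes ∈played = inj₂ ∈played
  ... | no ∉hand | no ∉played =
    ⊥-elim (proj₂ (proj₂ (invariant-star (stays-lost c) path (drawn , ∉hand , ∉played)))
                  played-later)

  playing-move : ∀ {t t' i} → Step a h t t' → ¬ (i ∈ played t) → i ∈ played t' →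
    HandDrawn t → toℕ i ≤ pos t × Playable (lastPl t) (a i)
  playing-move (drawDiscard _) ∉played ∈played _ = ⊥-elim (∉played ∈played)
  playing-move (drawStore _ _) ∉played ∈played _ = ⊥-elim (∉played ∈played)
  playing-move (drawPlay p playable) _ (here refl) _ = ≤-reflexive (FP.toℕ-fromℕ< p) , playable
  playing-move (drawPlay _ _) ∉played (there m) _ = ⊥-elim (∉played m)
  playing-move (playHand {xs = xs} c playable) _ (here refl) drawn =
    <⇒≤ (drawn c (∈-insert xs)) , playable
  playing-move (playHand _ _) ∉played (there m) _ = ⊥-elim (∉played m)

  moment-of-play : ∀ {s i} → Reachable a h s → i ∈ played s →
    ∃ λ t → Reachable a h t × Star (Step a h) t s × toℕ i ≤ pos t × Playable (lastPl t) (a i)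
  moment-of-play {i = i} reach ∈played
    with first-step-where (λ t → i ∈? played t) reach (λ ()) ∈played
  ... | t , t' , before , step , after , ∉played-t , ∈played-t' =
    t , before , step ◅ after ,
    playing-move step ∉played-t ∈played-t' (invariant-star hand-drawn before (λ _ ()))

  -- Blockers of card i in state s: h+1 distinct earlier cards of higher value,
  -- all played in s.  They must all wait in hand while i is played.
  record Blockers (s : State N) (i : Fin N) : Set where
    field
      card     : Fin (suc h) → Fin N
      distinct : Injective _≡_ _≡_ card
      earlier  : ∀ k → card k F.< i
      higher   : ∀ k → a i < a (card k)
      played-s : ∀ k → card k ∈ played s

  blocked-never-played : ∀ {s i} → Reachable a h s → Blockers s i → ¬ (i ∈ played s)
  blocked-never-played reach blockers ∈played
    with moment-of-play reach ∈played
  ... | t , reach-t , t⟶s , i-drawn , i-playable =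
    injective-in-short-list (hand t) card distinct in-hand
      (s≤s (invariant-star hand-bounded reach-t z≤n))
    where
    open Blockers blockers

    below : PlayedBelow t
    below = invariant-star played-below reach-t (λ _ ())

    in-hand : ∀ k → card k ∈ hand t
    in-hand k with drawn-and-later-played t⟶s (<-≤-trans (earlier k) i-drawn) (played-s k)
    ... | inj₁ ∈hand = ∈hand
    ... | inj₂ ∈played-t =
      ⊥-elim (<-asym (higher k) (playable-exceeds i-playable (below (card k) ∈played-t)))

-- In a won game, a useless card has blockers: the cards that played the
-- values w_1 < ... < w_{h+1}.
useless-has-blockers : ∀ {n h N} (a : Fin N → ℕ) → (∀ k → 1 ≤ a k × a k ≤ n) →
  ∀ {s i} → Winning a n s → Useless a n h i → Game.Blockers a h s i
useless-has-blockers {n} {h} {N} a bounds {s} {i} win (w , increasing , ai<w₀ , wₕ≤n , absent-later) =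
  record
    { card = card ; distinct = distinct ; earlier = earlier
    ; higher = higher ; played-s = λ k → proj₁ (proj₂ (witness k)) }
  where
  above-i : ∀ k → a i < w k
  above-i k = <-≤-trans ai<w₀ (increasing-monotone increasing {F.zero} {k} z≤n)

  witness : ∀ k → ∃ λ c → c ∈ played s × a c ≡ w k
  witness k = win (w k) (≤-trans (proj₁ (bounds i)) (<⇒≤ (above-i k)))
    (≤-trans (increasing-monotone increasing (FP.≤fromℕ k)) wₕ≤n)

  card : Fin (suc h) → Fin N
  card k = proj₁ (witness k)

  value : ∀ k → a (card k) ≡ w k
  value k = proj₂ (proj₂ (witness k))

  higher : ∀ k → a i < a (card k)
  higher k rewrite value k = above-i k

  distinct : Injective _≡_ _≡_ card
  distinct {k} {l} eq =
    increasing-injective increasing (trans (sym (value k)) (trans (cong a eq) (value l)))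

  earlier : ∀ k → card k F.< i
  earlier k with FP.<-cmp (card k) i
  ... | tri< before _ _ = before
  ... | tri≈ _ same _ = ⊥-elim (<-irrefl (cong a (sym same)) (higher k))
  ... | tri> _ _ after = ⊥-elim (absent-later (card k) after k (value k))

mainTheorem3 : (n h N : ℕ) (a : Fin N → ℕ) →
    (∀ k → 1 ≤ a k × a k ≤ n) →
    ∀ (s : State N) → Reachable a h s → Winning a n s →
    ∀ (i : Fin N) → Useless a n h i → ¬ (i ∈ played s)
mainTheorem3 n h N a bounds s reach win i useless =
  Game.blocked-never-played a h reach (useless-has-blockers a bounds win useless)
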